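{- Let $r\ge3$ be a fixed integer and $F$ a fixed $(0,1)$-matrix. Then $\log\operatorname{forb}(m,r,F)\sim m\log(r-1)$ as $m\to\infty$, i.e. $\log\operatorname{forb}(m,r,F)/(m\log(r-1))\to1$.
   Context: An $r$-matrix is a matrix with entries in $\{0,1,\dots,r-1\}$. A matrix is simple if it has no repeated columns. For matrices $F$ and $A$, $A$ avoids $F$ if no submatrix of $A$ is a row and column permutation of $F$. $\operatorname{forb}(m,r,F)$ is the maximum number of columns of a simple $m$-rowed $r$-matrix that avoids $F$. -}

module Defs where

open import Data.Nat using (ℕ; zero; suc; _+_; _*_; _∸_; _^_; _≤_; _<_)
open import Data.Fin using (Fin; toℕ)
open import Data.Product using (Σ; ∃; _×_; _,_)
open import Relation.Binary.PropositionalEquality using (_≡_)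
open import Relation.Nullary using (¬_)
open import Function.Definitions using (Injective)

Matrix : ℕ → ℕ → ℕ → Set
Matrix r m n = Fin m → Fin n → Fin r

01Matrix : ℕ → ℕ → Set
01Matrix k l = Fin k → Fin l → Fin 2

Simple : ∀ {r m n} → Matrix r m n → Set
Simple {n = n} A = (i j : Fin n) → (∀ a → A a i ≡ A a j) → i ≡ j

-- Choosing injective maps
-- ρ, γ (in any order) covers both the submatrix selection and the permutation.
Contains : ∀ {r m n k l} → Matrix r m n → 01Matrix k l → Set
Contains {r} {m} {n} {k} {l} A F =
  Σ (Fin k → Fin m) λ ρ → Σ (Fin l → Fin n) λ γ →
    Injective _≡_ _≡_ ρ × Injective _≡_ _≡_ γ ×
    (∀ a b → toℕ (A (ρ a) (γ b)) ≡ toℕ (F a b))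

Avoids : ∀ {r m n k l} → Matrix r m n → 01Matrix k l → Set
Avoids A F = ¬ Contains A F

IsForb : ∀ {k l} → (r : ℕ) → 01Matrix k l → (m N : ℕ) → Set
IsForb r F m N =
  (Σ (Matrix r m N) λ A → Simple A × Avoids A F) ×
  (∀ n (A : Matrix r m n) → Simple A → Avoids A F → n ≤ N)

-- log f(m) / (m log b) → 1, with logs eliminated: for every rational ε = p/q > 0
-- eventually  b^(m(1-ε)) ≤ f(m) ≤ b^(m(1+ε)),  raised to the q-th power.
LogRatioTendsToOne : (ℕ → ℕ) → ℕ → Set
LogRatioTendsToOne f b =
  ∀ p q → 0 < p → 0 < q →
    ∃ λ M → ∀ m → M ≤ m →
      (b ^ (m * q) ≤ (f m ^ q) * b ^ (m * p)) ×
      (f m ^ q ≤ b ^ (m * (q + p)))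

module Submission where

-- Let b = r - 1 ≥ 2.  We show  b^m ≤ forb(m, r, F) ≤ (m+1)^(k+l) · b^m,  from which
-- log forb(m, r, F) ~ m log b follows because a polynomial factor is eventually
-- smaller than b^(εm) for every rational ε > 0.
--
-- Lower bound: the b^m words avoiding the letter F₁₁ are the columns of a simple matrix
-- that cannot contain F.  Upper bound (a Sauer–Shelah type argument): the columns of a
-- simple matrix avoiding F form a set of words that shatters no k + l rows, since
-- shattering them would show every column of F stacked on a unit vector, i.e. a copy
-- of F; and a set of words over r letters shattering no t rows has at most
-- (m+1)^t · (r-1)^m elements, by induction on m splitting the set by its first letter.

open import Data.Nat using (ℕ; zero; suc; _+_; _*_; _∸_; _^_; _≤_; _<_; z≤n; s≤s; NonZero)
open import Data.Nat.Properties hiding (_≟_)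
open import Data.Nat.DivMod using (_/_; _%_; m≡m%n+[m/n]*n; m%n<n; m*n/n≡m; m/n*n≤m; /-monoˡ-≤)
open import Data.Nat.Tactic.RingSolver using (solve-∀)
open import Data.Bool using (Bool; true; false; _∧_; _∨_; not; if_then_else_)
open import Data.Bool.Properties using (∧-conicalˡ; ∧-conicalʳ; ∨-sel)
open import Data.Fin using (Fin; zero; suc; toℕ; _≟_; punchIn; fromℕ<; _↑ˡ_; _↑ʳ_; finToFun; funToFin; combine)
open import Data.Fin.Properties using (any?; punchIn-injective; punchInᵢ≢i; toℕ-fromℕ<; toℕ-injective; toℕ<n; funToFin-finToFin; ↑ˡ-injective) renaming (suc-injective to fsuc-injective)
open import Data.Fin.Patterns using (0F; 1F)
open import Data.Vec using (Vec; []; _∷_; lookup; tabulate)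
open import Data.Vec.Properties using (≡-dec; lookup∘tabulate)
open import Data.Vec.Functional using (_++_)
open import Data.Vec.Functional.Properties using (lookup-++ˡ; lookup-++ʳ)
open import Data.Product using (Σ; ∃; _×_; _,_; proj₁; proj₂)
open import Data.Sum using (inj₁; inj₂)
open import Data.Empty using (⊥-elim)
open import Relation.Nullary using (¬_; yes; does)
open import Relation.Nullary.Decidable using (dec-true; dec-false)
open import Relation.Binary.PropositionalEquality
open import Function using (_∘_)
open import Function.Definitions using (Injective)
open import Algebra.Properties.CommutativeMonoid.Sum +-0-commutativeMonoid
  using (sum; sum-cong-≗; sum-replicate-zero; ∑-distrib-+)

open import Defs

WordSet : ℕ → ℕ → Set
WordSet r m = Vec (Fin r) m → Bool

section : ∀ {r m} → WordSet r (suc m) → Fin r → WordSet r m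
section S x v = S (x ∷ v)

_∪_ _∩_ : ∀ {r m} → WordSet r m → WordSet r m → WordSet r m
(S ∪ T) v = S v ∨ T v
(S ∩ T) v = S v ∧ T v

_∖_ : ∀ {r m} → WordSet r m → WordSet r m → WordSet r m
(S ∖ P) v = S v ∧ not (P v)

singleton : ∀ {r m} → Vec (Fin r) m → WordSet r m
singleton w v = does (≡-dec _≟_ v w)

indicator : Bool → ℕ
indicator b = if b then 1 else 0

size : ∀ {r} m → WordSet r m → ℕ
size zero    S = indicator (S [])
size (suc m) S = sum (λ x → size m (section S x))

term≤sum : ∀ {n} (f : Fin n → ℕ) i → f i ≤ sum f
term≤sum f zero    = m≤m+n (f zero) _
term≤sum f (suc i) = ≤-trans (term≤sum (f ∘ suc) i) (m≤n+m _ (f zero))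

sum≤* : ∀ {n} (f : Fin n → ℕ) c → (∀ i → f i ≤ c) → sum f ≤ n * c
sum≤* {zero}  f c f≤c = z≤n
sum≤* {suc n} f c f≤c = +-mono-≤ (f≤c zero) (sum≤* (f ∘ suc) c (f≤c ∘ suc))

size-cong : ∀ {r} m {S T : WordSet r m} → (∀ v → S v ≡ T v) → size m S ≡ size m T
size-cong zero    S≐T = cong indicator (S≐T [])
size-cong (suc m) S≐T = sum-cong-≗ (λ x → size-cong m (λ v → S≐T (x ∷ v)))

size-empty : ∀ {r} m {S : WordSet r m} → (∀ v → S v ≡ false) → size m S ≡ 0
size-empty zero    S≐∅ rewrite S≐∅ [] = refl
size-empty {r} (suc m) S≐∅ =
  trans (sum-cong-≗ (λ x → size-empty m (λ v → S≐∅ (x ∷ v)))) (sum-replicate-zero r)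

size₀≤1 : ∀ {r} (S : WordSet r 0) → size 0 S ≤ 1
size₀≤1 S with S []
... | true  = ≤-refl
... | false = z≤n

size-positive : ∀ {r} m (S : WordSet r m) v → S v ≡ true → 1 ≤ size m S
size-positive zero    S []      v∈S rewrite v∈S = ≤-refl
size-positive (suc m) S (x ∷ v) v∈S =
  ≤-trans (size-positive m (section S x) v v∈S) (term≤sum (λ y → size m (section S y)) x)

size-∪-∩ : ∀ {r} m (S T : WordSet r m) → size m S + size m T ≡ size m (S ∪ T) + size m (S ∩ T)
size-∪-∩ zero S T = indicator-∨-∧ (S []) (T [])
  where
  indicator-∨-∧ : ∀ a b → indicator a + indicator b ≡ indicator (a ∨ b) + indicator (a ∧ b)
  indicator-∨-∧ true  true  = refl
  indicator-∨-∧ true  false = refl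
  indicator-∨-∧ false true  = refl
  indicator-∨-∧ false false = refl
size-∪-∩ {r} (suc m) S T = begin
  sum |S| + sum |T|                       ≡⟨ ∑-distrib-+ |S| |T| ⟨
  sum (λ x → |S| x + |T| x)                ≡⟨ sum-cong-≗ (λ x → size-∪-∩ m (section S x) (section T x)) ⟩
  sum (λ x → |S∪T| x + |S∩T| x)            ≡⟨ ∑-distrib-+ |S∪T| |S∩T| ⟩
  sum |S∪T| + sum |S∩T|                   ∎
  where
  open ≡-Reasoning
  |S| |T| |S∪T| |S∩T| : Fin r → ℕ
  |S|   x = size m (section S x)
  |T|   x = size m (section T x)
  |S∪T| x = size m (section (S ∪ T) x)
  |S∩T| x = size m (section (S ∩ T) x)

size-split : ∀ {r} m (S P : WordSet r m) → size m S ≡ size m (S ∩ P) + size m (S ∖ P)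
size-split m S P = begin
  size m S                                          ≡⟨ size-cong m (λ v → reassemble (S v) (P v)) ⟨
  size m ((S ∩ P) ∪ (S ∖ P))                        ≡⟨ +-identityʳ _ ⟨
  size m ((S ∩ P) ∪ (S ∖ P)) + 0                    ≡⟨ cong (size m ((S ∩ P) ∪ (S ∖ P)) +_) (size-empty m (λ v → disjoint (S v) (P v))) ⟨
  size m ((S ∩ P) ∪ (S ∖ P)) + size m ((S ∩ P) ∩ (S ∖ P))  ≡⟨ size-∪-∩ m (S ∩ P) (S ∖ P) ⟨
  size m (S ∩ P) + size m (S ∖ P)                   ∎
  where
  open ≡-Reasoning
  reassemble : ∀ a p → (a ∧ p) ∨ (a ∧ not p) ≡ a
  reassemble true  true  = refl
  reassemble true  false = refl
  reassemble false _     = refl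
  disjoint : ∀ a p → (a ∧ p) ∧ (a ∧ not p) ≡ false
  disjoint true  true  = refl
  disjoint true  false = refl
  disjoint false _     = refl

size-injective : ∀ {r} m {n} (S : WordSet r m) (f : Fin n → Vec (Fin r) m) →
  Injective _≡_ _≡_ f → (∀ i → S (f i) ≡ true) → n ≤ size m S
size-injective m {zero}  S f f-inj f∈S = z≤n
size-injective m {suc n} S f f-inj f∈S = begin
  1 + n                                         ≤⟨ +-mono-≤ first-counted rest-counted ⟩
  size m (S ∩ singleton (f 0F)) + size m (S ∖ singleton (f 0F))  ≡⟨ size-split m S (singleton (f 0F)) ⟨
  size m S                                      ∎
  where
  open ≤-Reasoning
  first-counted : 1 ≤ size m (S ∩ singleton (f 0F))
  first-counted = size-positive m _ (f 0F)
    (cong₂ _∧_ (f∈S 0F) (dec-true (≡-dec _≟_ (f 0F) (f 0F)) refl))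
  rest∈S∖f₀ : ∀ i → (S ∖ singleton (f 0F)) (f (suc i)) ≡ true
  rest∈S∖f₀ i = cong₂ (λ a b → a ∧ not b) (f∈S (suc i))
    (dec-false (≡-dec _≟_ (f (suc i)) (f 0F)) (λ fᵢ≡f₀ → 0≢suc (f-inj fᵢ≡f₀)))
    where
    0≢suc : ¬ suc i ≡ 0F
    0≢suc ()
  rest-counted : n ≤ size m (S ∖ singleton (f 0F))
  rest-counted = size-injective m _ (f ∘ suc) (λ e → fsuc-injective (f-inj e)) rest∈S∖f₀

Shows : ∀ {r m t} → Vec (Fin r) m → (Fin t → Fin m) → (Fin t → Fin 2) → Set
Shows v ρ p = ∀ a → toℕ (lookup v (ρ a)) ≡ toℕ (p a)

Shatters : ∀ {r m} → WordSet r m → ℕ → Set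
Shatters {r} {m} S t = Σ (Fin t → Fin m) λ ρ → Injective _≡_ _≡_ ρ ×
  ((p : Fin t → Fin 2) → Σ (Vec (Fin r) m) λ v → S v ≡ true × Shows v ρ p)

¬shatters-zero⇒empty : ∀ {r m} (S : WordSet r m) → ¬ Shatters S 0 → ∀ v → S v ≡ false
¬shatters-zero⇒empty S ¬sh v with S v in v∈S
... | true  = ⊥-elim (¬sh ((λ ()) , (λ { {()} }) , λ p → v , v∈S , λ ()))
... | false = refl

shatters-extend : ∀ {r m t} (S : WordSet r (suc m)) (T : WordSet r m) →
  (∀ v → T v ≡ true → ∃ λ x → S (x ∷ v) ≡ true) → Shatters T t → Shatters S t
shatters-extend S T extend (ρ , ρ-inj , shown) = suc ∘ ρ , ρ-inj ∘ fsuc-injective , shown⁺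
  where
  shown⁺ : ∀ p → Σ _ λ w → S w ≡ true × Shows w (suc ∘ ρ) p
  shown⁺ p with shown p
  ... | v , v∈T , v-shows with extend v v∈T
  ...   | x , xv∈S = x ∷ v , xv∈S , v-shows

-- If the sections of S at the letters 0 and 1 have a common shattered set of t rows, then
-- S shatters these rows together with its first row, whose value the first letter supplies.
shatters-add-row : ∀ {c m t} (S : WordSet (2 + c) (suc m)) →
  Shatters (section S 0F ∩ section S 1F) t → Shatters S (suc t)
shatters-add-row {m = m} {t} S (ρ , ρ-inj , shown) = ρ⁺ , ρ⁺-inj , shown⁺
  where
  ρ⁺ : Fin (suc t) → Fin (suc m)
  ρ⁺ zero    = zero
  ρ⁺ (suc a) = suc (ρ a)
  ρ⁺-inj : Injective _≡_ _≡_ ρ⁺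
  ρ⁺-inj {zero}  {zero}  _ = refl
  ρ⁺-inj {suc a} {suc b} e = cong suc (ρ-inj (fsuc-injective e))
  shown⁺ : ∀ p → Σ _ λ w → S w ≡ true × Shows w ρ⁺ p
  shown⁺ p with shown (p ∘ suc) | p zero in p₀
  ... | v , v∈S₀∩S₁ , v-shows | 0F =
    0F ∷ v , ∧-conicalˡ _ _ v∈S₀∩S₁ , λ { zero → cong toℕ (sym p₀) ; (suc a) → v-shows a }
  ... | v , v∈S₀∩S₁ , v-shows | 1F =
    1F ∷ v , ∧-conicalʳ _ _ v∈S₀∩S₁ , λ { zero → cong toℕ (sym p₀) ; (suc a) → v-shows a }

shattering-step : ∀ b .{{_ : NonZero b}} m t →
  b * (suc m ^ suc t * b ^ m) + suc m ^ t * b ^ m ≤ suc (suc m) ^ suc t * (b * b ^ m)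
shattering-step b m t = begin
  b * (suc m * P * B) + P * B          ≤⟨ +-monoʳ-≤ (b * (suc m * P * B)) (m≤n*m (P * B) b) ⟩
  b * (suc m * P * B) + b * (P * B)    ≡⟨ regroup b m P B ⟩
  b * (suc (suc m) * P * B)            ≤⟨ *-monoʳ-≤ b (*-monoˡ-≤ B (*-monoʳ-≤ (suc (suc m)) P≤Q)) ⟩
  b * (suc (suc m) * Q * B)            ≡⟨ reorder b (suc (suc m)) Q B ⟩
  suc (suc m) * Q * (b * B)            ∎
  where
  open ≤-Reasoning
  P Q B : ℕ
  P = suc m ^ t
  Q = suc (suc m) ^ t
  B = b ^ m
  P≤Q : P ≤ Q
  P≤Q = ^-monoˡ-≤ t (n≤1+n (suc m))
  regroup : ∀ b m P B → b * (suc m * P * B) + b * (P * B) ≡ b * (suc (suc m) * P * B)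
  regroup = solve-∀
  reorder : ∀ b x Q B → b * (x * Q * B) ≡ x * Q * (b * B)
  reorder = solve-∀

-- Induction on m: split S into its sections and
-- trade the sections at the letters 0 and 1 for their union and intersection.  The
-- union and the remaining c sections shatter no t rows (shatters-extend), and the
-- intersection shatters no t - 1 rows (shatters-add-row).
shattering-bound : ∀ {c} m t (S : WordSet (2 + c) m) → ¬ Shatters S t →
  size m S ≤ suc m ^ t * suc c ^ m
shattering-bound m zero S ¬sh rewrite size-empty m (¬shatters-zero⇒empty S ¬sh) = z≤n
shattering-bound zero (suc t) S ¬sh =
  ≤-trans (size₀≤1 S) (≤-reflexive (sym (cong (_* 1) (^-zeroˡ (suc t)))))
shattering-bound {c} (suc m) (suc t) S ¬sh = begin
  size m S₀ + (size m S₁ + rest)                      ≡⟨ +-assoc (size m S₀) (size m S₁) rest ⟨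
  size m S₀ + size m S₁ + rest                        ≡⟨ cong (_+ rest) (size-∪-∩ m S₀ S₁) ⟩
  size m (S₀ ∪ S₁) + size m (S₀ ∩ S₁) + rest          ≤⟨ +-mono-≤ (+-mono-≤ union-bound intersection-bound) rest-bound ⟩
  X + Y + c * X                                       ≡⟨ regroup X Y c ⟩
  suc c * X + Y                                       ≤⟨ shattering-step (suc c) m t ⟩
  suc (suc m) ^ suc t * suc c ^ suc m                 ∎
  where
  open ≤-Reasoning
  S₀ S₁ : WordSet (2 + c) m
  S₀ = section S 0F
  S₁ = section S 1F
  rest X Y : ℕ
  rest = sum (λ x → size m (section S (suc (suc x))))
  X = suc m ^ suc t * suc c ^ m
  Y = suc m ^ t * suc c ^ m
  regroup : ∀ X Y c → X + Y + c * X ≡ suc c * X + Y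
  regroup = solve-∀
  union-extends : ∀ v → (S₀ ∪ S₁) v ≡ true → ∃ λ x → S (x ∷ v) ≡ true
  union-extends v v∈S₀∪S₁ with ∨-sel (S₀ v) (S₁ v)
  ... | inj₁ ∪≡S₀ = 0F , trans (sym ∪≡S₀) v∈S₀∪S₁
  ... | inj₂ ∪≡S₁ = 1F , trans (sym ∪≡S₁) v∈S₀∪S₁
  union-bound : size m (S₀ ∪ S₁) ≤ X
  union-bound = shattering-bound m (suc t) (S₀ ∪ S₁) (¬sh ∘ shatters-extend S _ union-extends)
  intersection-bound : size m (S₀ ∩ S₁) ≤ Y
  intersection-bound = shattering-bound m t (S₀ ∩ S₁) (¬sh ∘ shatters-add-row S)
  rest-bound : rest ≤ c * X
  rest-bound = sum≤* _ X λ x → shattering-bound m (suc t) (section S (suc (suc x)))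
    (¬sh ∘ shatters-extend S _ (λ v v∈Sₓ → suc (suc x) , v∈Sₓ))

column : ∀ {r m n} → Matrix r m n → Fin n → Vec (Fin r) m
column A j = tabulate (λ a → A a j)

columns : ∀ {r m n} → Matrix r m n → WordSet r m
columns A v = does (any? (λ j → ≡-dec _≟_ (column A j) v))

column∈columns : ∀ {r m n} (A : Matrix r m n) j → columns A (column A j) ≡ true
column∈columns A j = dec-true (any? (λ i → ≡-dec _≟_ (column A i) (column A j))) (j , refl)

column-of : ∀ {r m n} (A : Matrix r m n) v → columns A v ≡ true → ∃ λ j → column A j ≡ v
column-of A v v∈A with any? (λ j → ≡-dec _≟_ (column A j) v)
... | yes found = found

column-injective : ∀ {r m n} (A : Matrix r m n) → Simple A → Injective _≡_ _≡_ (column A)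
column-injective A simple {i} {j} cᵢ≡cⱼ = simple i j λ a → begin
  A a i                   ≡⟨ lookup∘tabulate (λ a → A a i) a ⟨
  lookup (column A i) a   ≡⟨ cong (λ v → lookup v a) cᵢ≡cⱼ ⟩
  lookup (column A j) a   ≡⟨ lookup∘tabulate (λ a → A a j) a ⟩
  A a j                   ∎
  where open ≡-Reasoning

unit : ∀ {l} → Fin l → Fin l → Fin 2
unit b i = if does (i ≟ b) then 1F else 0F

unit-diagonal : ∀ {l} (b : Fin l) → unit b b ≡ 1F
unit-diagonal b rewrite dec-true (b ≟ b) refl = refl

unit-one : ∀ {l} (b i : Fin l) → toℕ (unit b i) ≡ 1 → i ≡ b
unit-one b i unitᵢ≡1 with i ≟ b
... | yes i≡b = i≡b

F-pattern : ∀ {k l} → 01Matrix k l → Fin l → Fin (k + l) → Fin 2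
F-pattern F b = (λ a → F a b) ++ unit b

-- If the columns of A shatter k + l rows then A contains F: a column γ b showing
-- F-pattern F b reads column b of F on the first k rows, and the unit vectors below
-- make γ injective.
shatters⇒contains : ∀ {r m n k l} (A : Matrix r m n) (F : 01Matrix k l) →
  Shatters (columns A) (k + l) → Contains A F
shatters⇒contains {n = n} {k} {l} A F (ρ , ρ-inj , shown) =
  ρ ∘ (_↑ˡ l) , γ , (λ e → ↑ˡ-injective l _ _ (ρ-inj e)) , γ-inj , reads-F
  where
  showing-column : ∀ b → ∃ λ j → ∀ x → toℕ (A (ρ x) j) ≡ toℕ (F-pattern F b x)
  showing-column b with shown (F-pattern F b)
  ... | v , v∈A , v-shows with column-of A v v∈A
  ...   | j , refl = j , λ x → trans (cong toℕ (sym (lookup∘tabulate (λ a → A a j) (ρ x)))) (v-shows x)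
  γ : Fin l → Fin n
  γ b = proj₁ (showing-column b)
  reads-F : ∀ a b → toℕ (A (ρ (a ↑ˡ l)) (γ b)) ≡ toℕ (F a b)
  reads-F a b = trans (proj₂ (showing-column b) (a ↑ˡ l)) (cong toℕ (lookup-++ˡ (λ a → F a b) (unit b) a))
  reads-unit : ∀ b i → toℕ (A (ρ (k ↑ʳ i)) (γ b)) ≡ toℕ (unit b i)
  reads-unit b i = trans (proj₂ (showing-column b) (k ↑ʳ i)) (cong toℕ (lookup-++ʳ (λ a → F a b) (unit b) i))
  γ-inj : Injective _≡_ _≡_ γ
  γ-inj {b} {b′} γb≡γb′ = unit-one b′ b (begin
    toℕ (unit b′ b)               ≡⟨ reads-unit b′ b ⟨
    toℕ (A (ρ (k ↑ʳ b)) (γ b′))   ≡⟨ cong (λ j → toℕ (A (ρ (k ↑ʳ b)) j)) γb≡γb′ ⟨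
    toℕ (A (ρ (k ↑ʳ b)) (γ b))    ≡⟨ reads-unit b b ⟩
    toℕ (unit b b)                ≡⟨ cong toℕ (unit-diagonal b) ⟩
    1                             ∎)
    where open ≡-Reasoning

-- Upper bound: a simple m-rowed (c+2)-matrix avoiding a k × l matrix F has at most
-- (m+1)^(k+l)·(c+1)^m columns, since its set of columns shatters no k + l rows.
avoiding-upper-bound : ∀ {c m n k l} (A : Matrix (2 + c) m n) (F : 01Matrix k l) →
  Simple A → Avoids A F → n ≤ suc m ^ (k + l) * suc c ^ m
avoiding-upper-bound {m = m} {k = k} {l} A F simple avoids = ≤-trans
  (size-injective m (columns A) (column A) (column-injective A simple) (column∈columns A))
  (shattering-bound m (k + l) (columns A) (avoids ∘ shatters⇒contains A F))

funToFin-cong : ∀ {m b} {f g : Fin m → Fin b} → (∀ a → f a ≡ g a) → funToFin f ≡ funToFin g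
funToFin-cong {zero}  f≐g = refl
funToFin-cong {suc m} f≐g = cong₂ combine (f≐g zero) (funToFin-cong (f≐g ∘ suc))

finToFun-injective : ∀ {m b} (i j : Fin (b ^ m)) →
  (∀ a → finToFun {b} {m} i a ≡ finToFun j a) → i ≡ j
finToFun-injective {m} {b} i j iᵃ≡jᵃ = begin
  i                               ≡⟨ funToFin-finToFin {m} {b} i ⟨
  funToFin {m} {b} (finToFun i)   ≡⟨ funToFin-cong iᵃ≡jᵃ ⟩
  funToFin {m} {b} (finToFun j)   ≡⟨ funToFin-finToFin {m} {b} j ⟩
  j                               ∎
  where open ≡-Reasoning

avoids-missing-letter : ∀ {r m n k l} (A : Matrix r m n) (F : 01Matrix k l) (s : Fin r) →
  (∀ a j → ¬ A a j ≡ s) → ∀ a b → toℕ (F a b) ≡ toℕ s → Avoids A F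
avoids-missing-letter A F s s∉A a b Fab≡s (ρ , γ , _ , _ , reads-F) =
  s∉A (ρ a) (γ b) (toℕ-injective (trans (reads-F a b) Fab≡s))

-- Lower bound: all b^m words over the letters of Fin (b+1) other than F's top-left
-- entry are the columns of a simple matrix avoiding F.
missing-letter-matrix : ∀ {b k l} m → 1 ≤ b → (F : 01Matrix (suc k) (suc l)) →
  Σ (Matrix (suc b) m (b ^ m)) λ A → Simple A × Avoids A F
missing-letter-matrix {b} m 1≤b F = A , simple , avoids
  where
  s : Fin (suc b)
  s = fromℕ< (≤-trans (toℕ<n (F 0F 0F)) (s≤s 1≤b))
  A : Matrix (suc b) m (b ^ m)
  A a i = punchIn s (finToFun i a)
  simple : Simple A
  simple i j Aᵢ≡Aⱼ = finToFun-injective {m} {b} i j (λ a → punchIn-injective s _ _ (Aᵢ≡Aⱼ a))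
  avoids : Avoids A F
  avoids = avoids-missing-letter A F s (λ a i → punchInᵢ≢i s _) 0F 0F (sym (toℕ-fromℕ< _))

-- (d+7)² ≤ 2^(d+6): each step adds 2d + 15 ≤ (d+7)² to the left and doubles the right.
square≤exp : ∀ d → (7 + d) * (7 + d) ≤ 2 ^ (6 + d)
square≤exp zero    = m≤m+n 49 15
square≤exp (suc d) = begin
  (8 + d) * (8 + d)                        ≡⟨ expand d ⟩
  (7 + d) * (7 + d) + (15 + 2 * d)         ≤⟨ +-monoʳ-≤ ((7 + d) * (7 + d)) increment≤square ⟩
  (7 + d) * (7 + d) + (7 + d) * (7 + d)    ≤⟨ +-mono-≤ (square≤exp d) (square≤exp d) ⟩
  2 ^ (6 + d) + 2 ^ (6 + d)                ≡⟨ cong (2 ^ (6 + d) +_) (+-identityʳ _) ⟨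
  2 ^ (7 + d)                              ∎
  where
  open ≤-Reasoning
  expand : ∀ d → (8 + d) * (8 + d) ≡ (7 + d) * (7 + d) + (15 + 2 * d)
  expand = solve-∀
  complete : ∀ d → 15 + 2 * d + (34 + 12 * d + d * d) ≡ (7 + d) * (7 + d)
  complete = solve-∀
  increment≤square : 15 + 2 * d ≤ (7 + d) * (7 + d)
  increment≤square = ≤-trans (m≤m+n (15 + 2 * d) _) (≤-reflexive (complete d))

linear≤exp : ∀ c s → c + 6 ≤ s → c * suc s ≤ 2 ^ s
linear≤exp c s c+6≤s = subst (λ s → c * suc s ≤ 2 ^ s) (m+[n∸m]≡n 6≤s)
  (≤-trans (*-monoˡ-≤ (7 + d) c≤7+d) (square≤exp d))
  where
  d : ℕ
  d = s ∸ 6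
  6≤s : 6 ≤ s
  6≤s = ≤-trans (m≤n+m 6 c) c+6≤s
  c≤7+d : c ≤ 7 + d
  c≤7+d = ≤-trans (m+n≤o⇒m≤o∸n c c+6≤s) (m≤n+m d 7)

-- Exponentials dominate polynomials: (m+1)^c ≤ 2^m for all large m.  Writing
-- m = s·c + (m mod c), one has m + 1 ≤ c·(s+1) ≤ 2^s, hence (m+1)^c ≤ 2^(s·c) ≤ 2^m.
poly≤exp : ∀ c → ∃ λ M → ∀ m → M ≤ m → suc m ^ c ≤ 2 ^ m
poly≤exp zero      = 0 , λ m _ → m^n>0 2 m
poly≤exp c@(suc _) = (c + 6) * c , bound
  where
  bound : ∀ m → (c + 6) * c ≤ m → suc m ^ c ≤ 2 ^ m
  bound m M≤m = begin
    suc m ^ c          ≤⟨ ^-monoˡ-≤ c m<c*[s+1] ⟩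
    (c * suc s) ^ c    ≤⟨ ^-monoˡ-≤ c (linear≤exp c s c+6≤s) ⟩
    (2 ^ s) ^ c        ≡⟨ ^-*-assoc 2 s c ⟩
    2 ^ (s * c)        ≤⟨ ^-monoʳ-≤ 2 (m/n*n≤m m c) ⟩
    2 ^ m              ∎
    where
    open ≤-Reasoning
    s : ℕ
    s = m / c
    c+6≤s : c + 6 ≤ s
    c+6≤s = ≤-trans (≤-reflexive (sym (m*n/n≡m (c + 6) c))) (/-monoˡ-≤ c M≤m)
    m<c*[s+1] : suc m ≤ c * suc s
    m<c*[s+1] = begin
      suc m                 ≡⟨ cong suc (m≡m%n+[m/n]*n m c) ⟩
      suc (m % c + s * c)   ≤⟨ +-monoˡ-≤ (s * c) (m%n<n m c) ⟩
      c + s * c             ≡⟨ cong (c +_) (*-comm s c) ⟩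
      c + c * s             ≡⟨ *-suc c s ⟨
      c * suc s             ∎

^-distribʳ-* : ∀ x y q → (x * y) ^ q ≡ x ^ q * y ^ q
^-distribʳ-* x y zero    = refl
^-distribʳ-* x y (suc q) = begin
  x * y * (x * y) ^ q         ≡⟨ cong (x * y *_) (^-distribʳ-* x y q) ⟩
  x * y * (x ^ q * y ^ q)     ≡⟨ interchange x y (x ^ q) (y ^ q) ⟩
  x * x ^ q * (y * y ^ q)     ∎
  where
  open ≡-Reasoning
  interchange : ∀ a b c d → a * b * (c * d) ≡ a * c * (b * d)
  interchange = solve-∀

-- If b^m ≤ f(m) ≤ (m+1)^T·b^m for all m and b ≥ 2, then log f(m) ~ m log b: the
-- polynomial factor (m+1)^T is eventually below b^(εm) for every ε = p/q > 0.
log-sandwich : ∀ b → 2 ≤ b → ∀ T (f : ℕ → ℕ) →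
  (∀ m → b ^ m ≤ f m) → (∀ m → f m ≤ suc m ^ T * b ^ m) → LogRatioTendsToOne f b
log-sandwich b@(suc (suc _)) (s≤s (s≤s _)) T f lower upper p@(suc _) q (s≤s _) _ =
  proj₁ (poly≤exp (T * q)) , λ m M≤m → below m , above m M≤m
  where
  open ≤-Reasoning
  below : ∀ m → b ^ (m * q) ≤ f m ^ q * b ^ (m * p)
  below m = begin
    b ^ (m * q)              ≡⟨ ^-*-assoc b m q ⟨
    (b ^ m) ^ q              ≤⟨ ^-monoˡ-≤ q (lower m) ⟩
    f m ^ q                  ≤⟨ m≤m*n (f m ^ q) (b ^ (m * p)) {{m^n≢0 b (m * p)}} ⟩
    f m ^ q * b ^ (m * p)    ∎
  above : ∀ m → proj₁ (poly≤exp (T * q)) ≤ m → f m ^ q ≤ b ^ (m * (q + p))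
  above m M≤m = begin
    f m ^ q                            ≤⟨ ^-monoˡ-≤ q (upper m) ⟩
    (suc m ^ T * b ^ m) ^ q            ≡⟨ ^-distribʳ-* (suc m ^ T) (b ^ m) q ⟩
    (suc m ^ T) ^ q * (b ^ m) ^ q      ≡⟨ cong₂ _*_ (^-*-assoc (suc m) T q) (^-*-assoc b m q) ⟩
    suc m ^ (T * q) * b ^ (m * q)      ≤⟨ *-monoˡ-≤ (b ^ (m * q)) polynomial-factor ⟩
    b ^ (m * p) * b ^ (m * q)          ≡⟨ ^-distribˡ-+-* b (m * p) (m * q) ⟨
    b ^ (m * p + m * q)                ≡⟨ cong (b ^_) (exponent m p q) ⟩
    b ^ (m * (q + p))                  ∎
    where
    exponent : ∀ m p q → m * p + m * q ≡ m * (q + p)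
    exponent = solve-∀
    polynomial-factor : suc m ^ (T * q) ≤ b ^ (m * p)
    polynomial-factor = begin
      suc m ^ (T * q)   ≤⟨ proj₂ (poly≤exp (T * q)) m M≤m ⟩
      2 ^ m             ≤⟨ ^-monoˡ-≤ m (s≤s (s≤s z≤n)) ⟩
      b ^ m             ≤⟨ ^-monoʳ-≤ b (m≤m*n m p) ⟩
      b ^ (m * p)       ∎

corollary3p2 : (r : ℕ) → 3 ≤ r → (k l : ℕ) → 0 < k → 0 < l → (F : 01Matrix k l) →
    (forb : ℕ → ℕ) → (∀ m → IsForb r F m (forb m)) →
    LogRatioTendsToOne forb (r ∸ 1)
corollary3p2 (suc (suc (suc c))) (s≤s (s≤s (s≤s _))) (suc k) (suc l) (s≤s _) (s≤s _) F forb forb-is-forb =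
  log-sandwich (2 + c) (s≤s (s≤s z≤n)) (suc k + suc l) forb lower upper
  where
  -- The missing-letter matrix is one of the matrices that forb m bounds ...
  lower : ∀ m → (2 + c) ^ m ≤ forb m
  lower m with missing-letter-matrix m (s≤s z≤n) F
  ... | A , simple , avoids = proj₂ (forb-is-forb m) _ A simple avoids
  -- ... and forb m is attained by a simple matrix avoiding F.
  upper : ∀ m → forb m ≤ suc m ^ (suc k + suc l) * (2 + c) ^ m
  upper m with proj₁ (forb-is-forb m)
  ... | A , simple , avoids = avoiding-upper-bound A F simple avoids
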